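{- Let $\Gamma=(V,E)$ be a graph of order $n$. Then: (1) $A(\Gamma;1)<2^n$, and $A(\Gamma;1)$ equals the number of nonempty subsets $S\subseteq V$ such that the induced subgraph $\langle S\rangle$ is connected; (2) the number of cut vertex sets of $\Gamma$ equals $2^n-1-A(\Gamma;1)$.
   Context: All graphs are finite and simple with at least one vertex. A cut vertex set of $\Gamma=(V,E)$ is a subset $X\subsetneq V$ such that the subgraph induced by $V\setminus X$ is not connected. For a vertex $v$ and $X\subseteq V$, $\delta_X(v)$ is the number of neighbours of $v$ in $X$, $\delta_1$ the maximum degree, $\bar S=V\setminus S$, and $\mathcal{K}=[-\delta_1,\delta_1]\cap\mathbb{Z}$. A nonempty $S\subseteq V$ is a defensive $k$-alliance if $\delta_S(v)\ge\delta_{\bar S}(v)+k$ for all $v\in S$; its exact index of alliance is $k_S=\max\{k\in\mathcal{K}: S \text{ is a defensive } k\text{ -alliance}\}$. The alliance polynomial is $A(\Gamma;x)=\sum_{S} x^{n+k_S}$, the sum over all nonempty $S\subseteq V$ with $\langle S\rangle$ connected. -}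

module Defs where

open import Data.Bool using (Bool; true; false; _∧_; _∨_; not; if_then_else_)
open import Data.Nat using (ℕ; zero; suc; _+_; _*_; _^_; _⊔_)
open import Data.Fin using (Fin)
open import Data.Vec using (Vec; []; _∷_; lookup)
open import Data.List using (List; []; _∷_; map; concatMap; foldr; upTo; allFin)
open import Data.Bool.ListAction using (any; all)
open import Data.Nat.ListAction using (sum)
open import Data.Integer as ℤ using (ℤ; +_; ∣_∣)
open import Relation.Binary.PropositionalEquality using (_≡_)
open import Relation.Nullary.Decidable using (⌊_⌋)

record Graph (n : ℕ) : Set where
  field
    adj    : Fin n → Fin n → Bool
    sym    : ∀ u v → adj u v ≡ adj v u
    irrefl : ∀ v → adj v v ≡ false
open Graph public

-- Subsets of V = Fin n as characteristic vectors.
VSet : ℕ → Set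
VSet n = Vec Bool n

_∈ᵇ_ : ∀ {n} → Fin n → VSet n → Bool
v ∈ᵇ S = lookup S v

compl : ∀ {n} → VSet n → VSet n
compl [] = []
compl (b ∷ S) = not b ∷ compl S

allSubsets : (n : ℕ) → List (VSet n)
allSubsets zero = [] ∷ []
allSubsets (suc n) = concatMap (λ S → (false ∷ S) ∷ (true ∷ S) ∷ []) (allSubsets n)

nonempty : ∀ {n} → VSet n → Bool
nonempty {n} S = any (λ v → v ∈ᵇ S) (allFin n)

_⊆ᵇ_ : ∀ {n} → VSet n → VSet n → Bool
_⊆ᵇ_ {n} T S = all (λ v → not (v ∈ᵇ T) ∨ (v ∈ᵇ S)) (allFin n)

_minus_ : ∀ {n} → VSet n → VSet n → VSet n
[] minus [] = []
(a ∷ S) minus (b ∷ T) = (a ∧ not b) ∷ (S minus T)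

-- The induced subgraph ⟨S⟩ is connected: S is nonempty and for every partition
-- S = T ∪ (S \ T) into two nonempty parts there is an edge of Γ between T and S \ T.
connectedInduced : ∀ {n} → Graph n → VSet n → Bool
connectedInduced {n} Γ S =
  nonempty S ∧
  all (λ T → not (T ⊆ᵇ S ∧ nonempty T ∧ nonempty (S minus T))
             ∨ any (λ u → any (λ v → (u ∈ᵇ T) ∧ (v ∈ᵇ (S minus T)) ∧ adj Γ u v)
                              (allFin n)) (allFin n))
      (allSubsets n)

countᵇ : ∀ {A : Set} → (A → Bool) → List A → ℕ
countᵇ p xs = sum (map (λ x → if p x then 1 else 0) xs)

δ : ∀ {n} → Graph n → VSet n → Fin n → ℕ
δ {n} Γ X v = countᵇ (λ u → adj Γ v u ∧ (u ∈ᵇ X)) (allFin n)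

fullSet : (n : ℕ) → VSet n
fullSet zero = []
fullSet (suc n) = true ∷ fullSet n

δ₁ : ∀ {n} → Graph n → ℕ
δ₁ {n} Γ = foldr _⊔_ 0 (map (δ Γ (fullSet n)) (allFin n))

-- 𝒦 = [-δ₁, δ₁] ∩ ℤ, listed in decreasing order δ₁, δ₁-1, …, -δ₁
𝒦 : ∀ {n} → Graph n → List ℤ
𝒦 Γ = map (λ i → (+ δ₁ Γ) ℤ.- (+ i)) (upTo (suc (2 * δ₁ Γ)))

-- S is a defensive k-alliance: δ_S(v) ≥ δ_{S̄}(v) + k for all v ∈ S
-- (nonemptiness of S is required separately where it matters)
isDefensiveAlliance : ∀ {n} → Graph n → VSet n → ℤ → Bool
isDefensiveAlliance {n} Γ S k =
  all (λ v → not (v ∈ᵇ S) ∨ ⌊ (+ δ Γ (compl S) v) ℤ.+ k ℤ.≤? (+ δ Γ S v) ⌋) (allFin n)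

firstᵇ : ∀ {A : Set} → (A → Bool) → A → List A → A
firstᵇ p d [] = d
firstᵇ p d (x ∷ xs) = if p x then x else firstᵇ p d xs

-- exact index of alliance k_S = max { k ∈ 𝒦 : S is a defensive k-alliance }
-- (the maximum always exists for nonempty S since -δ₁ qualifies; the default
-- -δ₁ is therefore never used)
kIndex : ∀ {n} → Graph n → VSet n → ℤ
kIndex Γ S = firstᵇ (isDefensiveAlliance Γ S) (ℤ.- (+ δ₁ Γ)) (𝒦 Γ)

-- the alliance polynomial A(Γ;x) = Σ_{S ≠ ∅, ⟨S⟩ connected} x^(n + k_S), evaluated at x : ℕ.
-- n + k_S ≥ n - δ₁ ≥ 1, so the exponent is a natural number; it is taken as ∣ n + k_S ∣.
alliancePoly : ∀ {n} → Graph n → ℕ → ℕ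
alliancePoly {n} Γ x =
  sum (map (λ S → if nonempty S ∧ connectedInduced Γ S
                  then x ^ ∣ (+ n) ℤ.+ kIndex Γ S ∣ else 0)
           (allSubsets n))

numConnectedSubsets : ∀ {n} → Graph n → ℕ
numConnectedSubsets {n} Γ = countᵇ (λ S → nonempty S ∧ connectedInduced Γ S) (allSubsets n)

isCutVertexSet : ∀ {n} → Graph n → VSet n → Bool
isCutVertexSet {n} Γ X = nonempty (compl X) ∧ not (connectedInduced Γ (compl X))

numCutVertexSets : ∀ {n} → Graph n → ℕ
numCutVertexSets {n} Γ = countᵇ (isCutVertexSet Γ) (allSubsets n)

module Submission where

-- Evaluating the alliance polynomial at x = 1 turns every term
-- 1^(n + k_S) into 1, so A(Γ;1) simply counts the nonempty S ⊆ V with ⟨S⟩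
-- connected; the exact index k_S plays no role.  The remaining claims are
-- pure counting over the 2^n subsets of V:
--   * there are 2^n − 1 nonempty subsets;
--   * they split into the connected ones (A(Γ;1) of them) and the
--     disconnected ones;
--   * X ↦ V \ X is a bijection of subsets, so cut vertex sets (X ⊊ V with
--     ⟨V \ X⟩ disconnected) are equinumerous with nonempty disconnected sets.
-- Hence  #cut + A(Γ;1) + 1 = 2^n, which gives both A(Γ;1) < 2^n and the
-- formula for the number of cut vertex sets.

open import Defs hiding (sym)
open import Data.Nat using (ℕ; zero; suc; _+_; _^_; _<_; _≤_)
open import Data.Nat.Properties
  using (+-comm; +-assoc; +-identityʳ; ^-zeroˡ; m≤n+m; n<1+n; module ≤-Reasoning)
open import Data.Integer as ℤ using (ℤ; +_)
open import Data.Integer.Properties using (pos-+)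
open import Data.Integer.Tactic.RingSolver using (solve-∀)
open import Data.Product using (_×_; _,_)
open import Data.Bool using (Bool; true; false; _∧_; _∨_; not; if_then_else_)
open import Data.Fin using () renaming (suc to fsuc)
open import Data.Vec using (_∷_; lookup)
open import Data.List using (List; []; _∷_; map; concatMap)
open import Data.List.Properties using (map-tabulate)
open import Data.Nat.ListAction using (sum)
open import Data.Bool.ListAction using (or)
open import Function using (_∘_; id)
open import Relation.Binary.PropositionalEquality
  using (_≡_; refl; sym; trans; cong; cong₂; module ≡-Reasoning)

sumMap : ∀ {A : Set} → (A → ℕ) → List A → ℕ
sumMap f xs = sum (map f xs)

-- The 0/1 indicator of a Boolean; countᵇ p is definitionally sumMap (ind ∘ p).
ind : Bool → ℕ
ind b = if b then 1 else 0

sumMap-cong : ∀ {A : Set} {f g : A → ℕ} → (∀ x → f x ≡ g x) →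
  ∀ xs → sumMap f xs ≡ sumMap g xs
sumMap-cong f≗g []       = refl
sumMap-cong f≗g (x ∷ xs) = cong₂ _+_ (f≗g x) (sumMap-cong f≗g xs)

sumMap-+ : ∀ {A : Set} (f g : A → ℕ) (xs : List A) →
  sumMap (λ x → f x + g x) xs ≡ sumMap f xs + sumMap g xs
sumMap-+ f g []       = refl
sumMap-+ f g (x ∷ xs) = begin
  (f x + g x) + sumMap (λ y → f y + g y) xs  ≡⟨ cong (λ t → (f x + g x) + t) (sumMap-+ f g xs) ⟩
  (f x + g x) + (F + G)                      ≡⟨ +-assoc (f x) (g x) (F + G) ⟩
  f x + (g x + (F + G))                      ≡⟨ cong (λ t → f x + t) (sym (+-assoc (g x) F G)) ⟩
  f x + ((g x + F) + G)                      ≡⟨ cong (λ t → f x + (t + G)) (+-comm (g x) F) ⟩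
  f x + ((F + g x) + G)                      ≡⟨ cong (λ t → f x + t) (+-assoc F (g x) G) ⟩
  f x + (F + (g x + G))                      ≡⟨ sym (+-assoc (f x) F (g x + G)) ⟩
  (f x + F) + (g x + G)                      ∎
  where
  open ≡-Reasoning
  F = sumMap f xs
  G = sumMap g xs

countᵇ-split : ∀ {A : Set} (p q : A → Bool) (xs : List A) →
  countᵇ (λ x → p x ∧ not (q x)) xs + countᵇ (λ x → p x ∧ q x) xs ≡ countᵇ p xs
countᵇ-split p q xs =
  trans (sym (sumMap-+ (ind ∘ λ x → p x ∧ not (q x)) (ind ∘ λ x → p x ∧ q x) xs))
        (sumMap-cong split-ind xs)
  where
  split-ind : ∀ x → ind (p x ∧ not (q x)) + ind (p x ∧ q x) ≡ ind (p x)
  split-ind x with p x | q x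
  ... | true  | true  = refl
  ... | true  | false = refl
  ... | false | _     = refl

sumMap-allSubsets-suc : ∀ n (f : VSet (suc n) → ℕ) →
  sumMap f (allSubsets (suc n)) ≡ sumMap (λ S → f (false ∷ S) + f (true ∷ S)) (allSubsets n)
sumMap-allSubsets-suc n f = go (allSubsets n)
  where
  go : (xs : List (VSet n)) →
    sumMap f (concatMap (λ S → (false ∷ S) ∷ (true ∷ S) ∷ []) xs)
      ≡ sumMap (λ S → f (false ∷ S) + f (true ∷ S)) xs
  go []       = refl
  go (S ∷ xs) = trans (sym (+-assoc (f (false ∷ S)) _ _)) (cong (λ t → _ + t) (go xs))

sumMap-compl : ∀ n (f : VSet n → ℕ) →
  sumMap f (allSubsets n) ≡ sumMap (f ∘ compl) (allSubsets n)
sumMap-compl zero    f = refl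
sumMap-compl (suc n) f = begin
  sumMap f (allSubsets (suc n))
    ≡⟨ sumMap-allSubsets-suc n f ⟩
  sumMap (λ S → f (false ∷ S) + f (true ∷ S)) (allSubsets n)
    ≡⟨ sumMap-compl n _ ⟩
  sumMap (λ S → f (false ∷ compl S) + f (true ∷ compl S)) (allSubsets n)
    ≡⟨ sumMap-cong (λ S → +-comm (f (false ∷ compl S)) _) (allSubsets n) ⟩
  sumMap (λ S → f (true ∷ compl S) + f (false ∷ compl S)) (allSubsets n)
    ≡⟨ sym (sumMap-allSubsets-suc n (f ∘ compl)) ⟩
  sumMap (f ∘ compl) (allSubsets (suc n))
    ∎
  where open ≡-Reasoning

count-allSubsets : ∀ n → sumMap (λ (_ : VSet n) → 1) (allSubsets n) ≡ 2 ^ n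
count-allSubsets zero    = refl
count-allSubsets (suc n) = begin
  sumMap (λ _ → 1) (allSubsets (suc n))       ≡⟨ sumMap-allSubsets-suc n (λ _ → 1) ⟩
  sumMap (λ _ → 1 + 1) (allSubsets n)         ≡⟨ sumMap-+ (λ _ → 1) (λ _ → 1) (allSubsets n) ⟩
  sumMap (λ _ → 1) (allSubsets n) + sumMap (λ _ → 1) (allSubsets n)
                                              ≡⟨ cong₂ _+_ (count-allSubsets n) (count-allSubsets n) ⟩
  2 ^ n + 2 ^ n                               ≡⟨ cong (λ t → 2 ^ n + t) (sym (+-identityʳ (2 ^ n))) ⟩
  2 ^ (suc n)                                 ∎
  where open ≡-Reasoning

nonempty-∷ : ∀ {n} (b : Bool) (S : VSet n) → nonempty (b ∷ S) ≡ b ∨ nonempty S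
nonempty-∷ b S = cong (b ∨_) (trans (cong or (map-tabulate fsuc (lookup (b ∷ S))))
                                    (sym (cong or (map-tabulate id (lookup S)))))

count-nonempty : ∀ n → countᵇ nonempty (allSubsets n) + 1 ≡ 2 ^ n
count-nonempty zero    = refl
count-nonempty (suc n) = begin
  countᵇ nonempty (allSubsets (suc n)) + 1
    ≡⟨ cong (λ t → t + 1) (sumMap-allSubsets-suc n (ind ∘ nonempty)) ⟩
  sumMap (λ S → ind (nonempty (false ∷ S)) + ind (nonempty (true ∷ S))) (allSubsets n) + 1
    ≡⟨ cong (λ t → t + 1) (sumMap-cong extend (allSubsets n)) ⟩
  sumMap (λ S → ind (nonempty S) + 1) (allSubsets n) + 1
    ≡⟨ cong (λ t → t + 1) (sumMap-+ (ind ∘ nonempty) (λ _ → 1) (allSubsets n)) ⟩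
  (N + sumMap (λ _ → 1) (allSubsets n)) + 1
    ≡⟨ cong (λ t → (N + t) + 1) (count-allSubsets n) ⟩
  (N + 2 ^ n) + 1
    ≡⟨ +-assoc N (2 ^ n) 1 ⟩
  N + (2 ^ n + 1)
    ≡⟨ cong (λ t → N + t) (+-comm (2 ^ n) 1) ⟩
  N + (1 + 2 ^ n)
    ≡⟨ sym (+-assoc N 1 (2 ^ n)) ⟩
  (N + 1) + 2 ^ n
    ≡⟨ cong (λ t → t + 2 ^ n) (count-nonempty n) ⟩
  2 ^ n + 2 ^ n
    ≡⟨ cong (λ t → 2 ^ n + t) (sym (+-identityʳ (2 ^ n))) ⟩
  2 ^ (suc n)
    ∎
  where
  open ≡-Reasoning
  N = countᵇ nonempty (allSubsets n)
  extend : ∀ S → ind (nonempty (false ∷ S)) + ind (nonempty (true ∷ S)) ≡ ind (nonempty S) + 1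
  extend S rewrite nonempty-∷ false S | nonempty-∷ true S = refl

module _ {n : ℕ} (Γ : Graph n) where

  connected disconnected : VSet n → Bool
  connected    S = nonempty S ∧ connectedInduced Γ S
  disconnected S = nonempty S ∧ not (connectedInduced Γ S)

  alliancePoly-at-1 : alliancePoly Γ 1 ≡ numConnectedSubsets Γ
  alliancePoly-at-1 = sumMap-cong one-per-connected (allSubsets n)
    where
    one-per-connected : ∀ S →
      (if connected S then 1 ^ ℤ.∣ + n ℤ.+ kIndex Γ S ∣ else 0) ≡ ind (connected S)
    one-per-connected S with connected S
    ... | true  = ^-zeroˡ ℤ.∣ + n ℤ.+ kIndex Γ S ∣
    ... | false = refl

  cutVertexSets≡disconnected : numCutVertexSets Γ ≡ countᵇ disconnected (allSubsets n)
  cutVertexSets≡disconnected = sym (sumMap-compl n (ind ∘ disconnected))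

  -- Every subset is empty, connected or disconnected.
  subset-trichotomy :
    countᵇ disconnected (allSubsets n) + numConnectedSubsets Γ + 1 ≡ 2 ^ n
  subset-trichotomy =
    trans (cong (λ t → t + 1) (countᵇ-split nonempty (connectedInduced Γ) (allSubsets n)))
          (count-nonempty n)

solve-for-first : ∀ c a m → c + a + 1 ≡ m → + c ≡ + m ℤ.- + 1 ℤ.- + a
solve-for-first c a _ refl =
  trans (ring (+ c) (+ a))
        (cong (λ z → z ℤ.- + 1 ℤ.- + a)
              (sym (trans (pos-+ (c + a) 1) (cong (ℤ._+ + 1) (pos-+ c a)))))
  where
  ring : ∀ (x y : ℤ) → x ≡ x ℤ.+ y ℤ.+ + 1 ℤ.- + 1 ℤ.- y
  ring = solve-∀

theorem2p4 : (n : ℕ) → 1 ≤ n → (Γ : Graph n) →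
    (alliancePoly Γ 1 < 2 ^ n)
    × (alliancePoly Γ 1 ≡ numConnectedSubsets Γ)
    × ((+ numCutVertexSets Γ) ≡ (+ (2 ^ n)) ℤ.- (+ 1) ℤ.- (+ alliancePoly Γ 1))
theorem2p4 n _ Γ = A<2^n , alliancePoly-at-1 Γ , cutVertexSets-formula
  where
  c = countᵇ (disconnected Γ) (allSubsets n)

  total : c + alliancePoly Γ 1 + 1 ≡ 2 ^ n
  total = trans (cong (λ a → c + a + 1) (alliancePoly-at-1 Γ)) (subset-trichotomy Γ)

  A<2^n : alliancePoly Γ 1 < 2 ^ n
  A<2^n = begin-strict
    alliancePoly Γ 1          ≤⟨ m≤n+m (alliancePoly Γ 1) c ⟩
    c + alliancePoly Γ 1      <⟨ n<1+n _ ⟩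
    suc (c + alliancePoly Γ 1) ≡⟨ +-comm 1 _ ⟩
    c + alliancePoly Γ 1 + 1  ≡⟨ total ⟩
    2 ^ n                     ∎
    where open ≤-Reasoning

  cutVertexSets-formula : + numCutVertexSets Γ ≡ + (2 ^ n) ℤ.- + 1 ℤ.- + alliancePoly Γ 1
  cutVertexSets-formula =
    trans (cong +_ (cutVertexSets≡disconnected Γ))
          (solve-for-first c (alliancePoly Γ 1) (2 ^ n) total)
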